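{- Let $G=(V,E)$ be a simple graph with a pendant edge $e=\{u,w\}$, where $w$ has degree $1$. Then $\mathrm{np}(G)=\mathrm{nnp}(G_{ -u})\le \mathrm{nnp}(G_{ -v})$ for all $v\in V$, and in particular $\mathrm{np}(G)=\min\{\mathrm{nnp}(G_{ -v}) : v\in V\}$.
   Context: A matching is a set of edges no two of which share a vertex. A perfect matching covers all vertices; a near-perfect matching covers all vertices except exactly one. $\mathrm{np}(G)$ and $\mathrm{nnp}(G)$ denote the number of perfect matchings and the number of near-perfect matchings of $G$, respectively. $G_{ -v}$ denotes the graph obtained from $G$ by deleting $v$ and all edges incident to $v$. -}

module Defs where

open import Data.Nat using (ℕ; zero; suc; _+_; _⊓_; _≡ᵇ_; _≤ᵇ_)
open import Data.Bool using (Bool; true; false; not; _∧_; _∨_; if_then_else_)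
open import Data.Fin using (Fin; zero; suc; punchIn)
open import Data.List using (List; []; _∷_; map; concatMap; filter; length)
open import Relation.Binary.PropositionalEquality using (_≡_)
open import Relation.Nullary.Decidable using (Dec)
open import Data.Bool.Properties using (T?)
open import Data.Bool using (T)

record Graph (n : ℕ) : Set where
  field
    adj    : Fin n → Fin n → Bool
    sym    : ∀ i j → adj i j ≡ adj j i
    irrefl : ∀ i → adj i i ≡ false
open Graph public

_==_ : Bool → Bool → Bool
true  == b = b
false == b = not b

countF : ∀ {n} → (Fin n → Bool) → ℕ
countF {zero}  p = 0
countF {suc n} p = (if p zero then 1 else 0) + countF (λ i → p (suc i))

allF : ∀ {n} → (Fin n → Bool) → Bool
allF {zero}  p = true
allF {suc n} p = p zero ∧ allF (λ i → p (suc i))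

degree : ∀ {n} → Graph n → Fin n → ℕ
degree G v = countF (adj G v)

allFuns : ∀ {A : Set} (n : ℕ) → List A → List (Fin n → A)
allFuns zero    xs = (λ ()) ∷ []
allFuns (suc n) xs =
  concatMap (λ a → map (λ f → λ { zero → a ; (suc i) → f i }) (allFuns n xs)) xs

-- An edge set F of a graph on Fin n is represented by its (symmetric)
-- indicator relation; every symmetric relation contained in adj corresponds
-- to exactly one subset of E.
EdgeRel : ℕ → Set
EdgeRel n = Fin n → Fin n → Bool

allEdgeRels : (n : ℕ) → List (EdgeRel n)
allEdgeRels n = allFuns n (allFuns n (true ∷ false ∷ []))

isEdgeSubset : ∀ {n} → Graph n → EdgeRel n → Bool
isEdgeSubset G F =
  allF (λ i → allF (λ j → (not (F i j) ∨ adj G i j) ∧ (F i j == F j i)))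

degF : ∀ {n} → EdgeRel n → Fin n → ℕ
degF F v = countF (F v)

isMatching : ∀ {n} → Graph n → EdgeRel n → Bool
isMatching G F = isEdgeSubset G F ∧ allF (λ v → degF F v ≤ᵇ 1)

isPerfectMatching : ∀ {n} → Graph n → EdgeRel n → Bool
isPerfectMatching G F = isMatching G F ∧ allF (λ v → degF F v ≡ᵇ 1)

isNearPerfectMatching : ∀ {n} → Graph n → EdgeRel n → Bool
isNearPerfectMatching G F =
  isMatching G F ∧ (countF (λ v → degF F v ≡ᵇ 0) ≡ᵇ 1)

np : ∀ {n} → Graph n → ℕ
np {n} G = length (filter (λ F → T? (isPerfectMatching G F)) (allEdgeRels n))

nnp : ∀ {n} → Graph n → ℕ
nnp {n} G = length (filter (λ F → T? (isNearPerfectMatching G F)) (allEdgeRels n))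

deleteVertex : ∀ {n} → Graph (suc n) → Fin (suc n) → Graph n
deleteVertex G v = record
  { adj    = λ i j → adj G (punchIn v i) (punchIn v j)
  ; sym    = λ i j → sym G (punchIn v i) (punchIn v j)
  ; irrefl = λ i → irrefl G (punchIn v i)
  }

minOver : ∀ {n} → (Fin (suc n) → ℕ) → ℕ
minOver {zero}  f = f zero
minOver {suc n} f = f zero ⊓ minOver (λ i → f (suc i))

module Submission where

-- Deleting any vertex v from a perfect matching F of G leaves a near-perfect
-- matching of G − v: the only vertex left uncovered is the partner of v, and
-- F is recovered from its restriction since that partner is the unique
-- uncovered vertex.  Hence np G ≤ nnp (G − v) for every v.  Conversely, if w
-- is a pendant vertex with neighbour u, then w is isolated in G − u, so every
-- near-perfect matching of G − u misses exactly w and extends by the edge uw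
-- to a perfect matching of G; thus nnp (G − u) ≤ np G.  Both maps are
-- injective, which gives the inequalities between the counts.

open import Defs
open import Algebra.Properties.CommutativeSemigroup using (x∙yz≈y∙xz)
open import Data.Bool using (Bool; true; false; not; _∧_; _∨_; if_then_else_; T)
open import Data.Bool.Properties using (T?; T-∧)
open import Data.Fin using (Fin; zero; suc; _<_; punchIn; punchOut; _≟_)
open import Data.Fin.Properties using (pigeonhole; punchInᵢ≢i; punchIn-punchOut; punchIn-injective)
open import Data.List using (List; []; _∷_; map; concatMap; _++_; cartesianProductWith; filter; length; lookup)
open import Data.List.Membership.Propositional.Properties using () renaming (∈-lookup to ∈ₚ-lookup)
import Data.List.Membership.Setoid as Membership
open import Data.List.Membership.Setoid.Properties
  using (∈-lookup; index-injective; ∈-resp-≈; ∈-cartesianProductWith⁺; ∈-filter⁺; ∈-filter⁻)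
open import Data.List.Relation.Unary.All as All using ()
open import Data.List.Relation.Unary.AllPairs using (AllPairs; []; _∷_)
open import Data.List.Relation.Unary.Any using (here; there; index)
open import Data.List.Relation.Unary.Unique.Setoid using (Unique)
open import Data.List.Relation.Unary.Unique.Setoid.Properties
  using (cartesianProductWith⁺) renaming (filter⁺ to Unique-filter⁺)
open import Data.Nat using (ℕ; zero; suc; _+_; _≤_; z≤n; s≤s; _≡ᵇ_; _≤ᵇ_)
open import Data.Nat.Properties
  using (≮⇒≥; ≡ᵇ⇒≡; ≡⇒≡ᵇ; ≤⇒≤ᵇ; ≤ᵇ⇒≤; ≤-refl; ≤-reflexive; ≤-trans; ≤-antisym; suc-injective;
         m⊓n≤m; m⊓n≤n; ⊓-glb; +-commutativeSemigroup)
open import Data.Product using (_×_; _,_; proj₁; proj₂)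
open import Data.Vec.Functional using (insertAt)
open import Data.Vec.Functional.Properties using (insertAt-lookup; insertAt-punchIn)
open import Data.Vec.Functional.Relation.Binary.Pointwise.Properties using () renaming (setoid to Vecₛ)
open import Level using (0ℓ)
open import Function using (_∘_; _$_; _⇔_; mk⇔; Equivalence)
open import Relation.Binary using (Setoid; Rel)
open import Relation.Binary.PropositionalEquality
  using (_≡_; _≢_; refl; trans; cong; cong₂; subst; setoid; module ≡-Reasoning)
import Relation.Binary.PropositionalEquality as ≡
open import Relation.Nullary using (Dec; yes; no; does; contradiction)
open import Relation.Nullary.Decidable using (dec-true; dec-false)

open Equivalence using (to; from)

lookup-AllPairs : ∀ {a ℓ} {A : Set a} {R : Rel A ℓ} {xs : List A} → AllPairs R xs →
                  ∀ {i j} → i < j → R (lookup xs i) (lookup xs j)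
lookup-AllPairs (Rx ∷ _)   {zero}  {suc j} _         = All.lookup Rx (∈ₚ-lookup {xs = _} j)
lookup-AllPairs (_ ∷ pairs) {suc i} {suc j} (s≤s i<j) = lookup-AllPairs pairs i<j

module _ {a b ℓ₁ ℓ₂} (S₁ : Setoid a ℓ₁) (S₂ : Setoid b ℓ₂) where
  open Setoid S₁ using () renaming (Carrier to A; _≈_ to _≈₁_)
  open Setoid S₂ using () renaming (Carrier to B; _≈_ to _≈₂_)
  open Membership S₁ using () renaming (_∈_ to _∈₁_)
  open Membership S₂ using () renaming (_∈_ to _∈₂_)

  injection⇒length≤ : ∀ {xs ys} (f : A → B) → Unique S₁ xs →
                      (∀ {x} → x ∈₁ xs → f x ∈₂ ys) →
                      (∀ {x y} → x ∈₁ xs → y ∈₁ xs → f x ≈₂ f y → x ≈₁ y) →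
                      length xs ≤ length ys
  injection⇒length≤ {xs} {ys} f xs! into inj = ≮⇒≥ λ ys<xs →
    let i , j , i<j , same-position = pigeonhole ys<xs position
    in lookup-AllPairs xs! i<j
         (inj (∈-lookup S₁ xs i) (∈-lookup S₁ xs j)
              (index-injective S₂ (into (∈-lookup S₁ xs i)) (into (∈-lookup S₁ xs j)) same-position))
    where
    position : Fin (length xs) → Fin (length ys)
    position i = index (into (∈-lookup S₁ xs i))

concatMap-map≡cartesianProductWith : ∀ {A B C : Set} (f : A → B → C) xs ys →
  concatMap (λ x → map (f x) ys) xs ≡ cartesianProductWith f xs ys
concatMap-map≡cartesianProductWith f []       ys = refl
concatMap-map≡cartesianProductWith f (x ∷ xs) ys =
  cong (map (f x) ys ++_) (concatMap-map≡cartesianProductWith f xs ys)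

module _ {ℓ} (S : Setoid 0ℓ ℓ) where
  open Setoid S using () renaming (Carrier to A)
  open Membership S using (_∈_)

  allFuns-unique : ∀ n {xs} → Unique S xs → Unique (Vecₛ S n) (allFuns n xs)
  allFuns-unique zero    xs! = All.[] ∷ []
  allFuns-unique (suc n) {xs} xs! =
    subst (Unique (Vecₛ S (suc n))) (≡.sym (concatMap-map≡cartesianProductWith _ xs (allFuns n xs)))
      (cartesianProductWith⁺ S (Vecₛ S n) (Vecₛ S (suc n)) _
        (λ eq → eq zero , eq ∘ suc) xs! (allFuns-unique n xs!))

  allFuns-complete : ∀ n {xs} (f : Fin n → A) → (∀ i → f i ∈ xs) →
                     Membership._∈_ (Vecₛ S n) f (allFuns n xs)
  allFuns-complete zero    f _   = here λ ()
  allFuns-complete (suc n) {xs} f f∈xs =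
    subst (Membership._∈_ (Vecₛ S (suc n)) f) (≡.sym (concatMap-map≡cartesianProductWith _ xs (allFuns n xs)))
      (∈-resp-≈ (Vecₛ S (suc n)) (λ { zero → Setoid.refl S ; (suc i) → Setoid.refl S })
        (∈-cartesianProductWith⁺ S (Vecₛ S n) (Vecₛ S (suc n))
          (λ { a≈b g≋h zero → a≈b ; a≈b g≋h (suc i) → g≋h i })
          (f∈xs zero) (allFuns-complete n (f ∘ suc) (f∈xs ∘ suc))))

-- Edge relations are functions, so without function extensionality
-- allEdgeRels is duplicate-free and complete only up to pointwise equality.
EdgeRelₛ : ℕ → Setoid _ _
EdgeRelₛ n = Vecₛ (Vecₛ (setoid Bool) n) n

_≐_ : ∀ {n} → Rel (EdgeRel n) _
F ≐ F′ = ∀ i j → F i j ≡ F′ i j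

allEdgeRels-unique : ∀ n → Unique (EdgeRelₛ n) (allEdgeRels n)
allEdgeRels-unique n = allFuns-unique (Vecₛ (setoid Bool) n) n (allFuns-unique (setoid Bool) n booleans-unique)
  where
  booleans-unique : Unique (setoid Bool) (true ∷ false ∷ [])
  booleans-unique = ((λ ()) All.∷ All.[]) ∷ All.[] ∷ []

allEdgeRels-complete : ∀ {n} (F : EdgeRel n) → Membership._∈_ (EdgeRelₛ n) F (allEdgeRels n)
allEdgeRels-complete {n} F =
  allFuns-complete (Vecₛ (setoid Bool) n) n F λ i →
    allFuns-complete (setoid Bool) n (F i) λ j → boolean∈ (F i j)
  where
  boolean∈ : ∀ b → Membership._∈_ (setoid Bool) b (true ∷ false ∷ [])
  boolean∈ true  = here refl
  boolean∈ false = there (here refl)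

countEdgeRels : ∀ {n} → (EdgeRel n → Bool) → ℕ
countEdgeRels {n} p = length (filter (λ F → T? (p F)) (allEdgeRels n))

countEdgeRels-mono : ∀ {m n} (p : EdgeRel m → Bool) (q : EdgeRel n → Bool) (f : EdgeRel m → EdgeRel n) →
  (∀ {F F′} → F ≐ F′ → p F ≡ p F′) → (∀ {F F′} → F ≐ F′ → q F ≡ q F′) →
  (∀ {F} → T (p F) → T (q (f F))) →
  (∀ {F F′} → T (p F) → T (p F′) → f F ≐ f F′ → F ≐ F′) →
  countEdgeRels p ≤ countEdgeRels q
countEdgeRels-mono {m} {n} p q f p-cong q-cong p⇒q inj =
  injection⇒length≤ (EdgeRelₛ m) (EdgeRelₛ n) f
    (Unique-filter⁺ (EdgeRelₛ m) (λ F → T? (p F)) (allEdgeRels-unique m))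
    (λ F∈ → ∈-filter⁺ (EdgeRelₛ n) (λ F → T? (q F)) (respects q-cong) (allEdgeRels-complete _) (p⇒q (holds F∈)))
    (λ F∈ F′∈ → inj (holds F∈) (holds F′∈))
  where
  respects : ∀ {k} {r : EdgeRel k → Bool} → (∀ {F F′} → F ≐ F′ → r F ≡ r F′) → ∀ {F F′} → F ≐ F′ → T (r F) → T (r F′)
  respects r-cong F≐F′ = subst T (r-cong F≐F′)
  holds : ∀ {F} → Membership._∈_ (EdgeRelₛ m) F (filter (λ F → T? (p F)) (allEdgeRels m)) → T (p F)
  holds = proj₂ ∘ ∈-filter⁻ (EdgeRelₛ m) (λ F → T? (p F)) (respects p-cong) {xs = allEdgeRels m}

indicator : Bool → ℕ
indicator b = if b then 1 else 0

data PunchView {n} (v : Fin (suc n)) : Fin (suc n) → Set where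
  at      : PunchView v v
  punched : ∀ i → PunchView v (punchIn v i)

punchView : ∀ {n} (v x : Fin (suc n)) → PunchView v x
punchView v x with v ≟ x
... | yes refl = at
... | no  v≢x  = subst (PunchView v) (punchIn-punchOut v≢x) (punched (punchOut v≢x))

countF-cong : ∀ {n} {p q : Fin n → Bool} → (∀ i → p i ≡ q i) → countF p ≡ countF q
countF-cong {zero}  p≗q = refl
countF-cong {suc n} p≗q = cong₂ _+_ (cong indicator (p≗q zero)) (countF-cong (p≗q ∘ suc))

allF-cong : ∀ {n} {p q : Fin n → Bool} → (∀ i → p i ≡ q i) → allF p ≡ allF q
allF-cong {zero}  p≗q = refl
allF-cong {suc n} p≗q = cong₂ _∧_ (p≗q zero) (allF-cong (p≗q ∘ suc))

countF-punchIn : ∀ {n} (v : Fin (suc n)) (p : Fin (suc n) → Bool) →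
                 countF p ≡ indicator (p v) + countF (p ∘ punchIn v)
countF-punchIn         zero    p = refl
countF-punchIn {suc n} (suc v) p =
  trans (cong (indicator (p zero) +_) (countF-punchIn v (p ∘ suc)))
        (x∙yz≈y∙xz +-commutativeSemigroup (indicator (p zero)) (indicator (p (suc v))) _)

countF≡0⇒false : ∀ {n} {p : Fin n → Bool} → countF p ≡ 0 → ∀ i → p i ≡ false
countF≡0⇒false {suc n} {p} #p≡0 i with p zero in p0
countF≡0⇒false {suc n} {p} #p≡0 zero    | false = p0
countF≡0⇒false {suc n} {p} #p≡0 (suc i) | false = countF≡0⇒false #p≡0 i
countF≡0⇒false {suc n} {p} ()   _       | true

false⇒countF≡0 : ∀ {n} {p : Fin n → Bool} → (∀ i → p i ≡ false) → countF p ≡ 0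
false⇒countF≡0 {zero}  _     = refl
false⇒countF≡0 {suc n} p≡false = cong₂ _+_ (cong indicator (p≡false zero)) (false⇒countF≡0 (p≡false ∘ suc))

countF≡1⇒unique : ∀ {n} {p : Fin n → Bool} → countF p ≡ 1 →
                  ∀ {a b} → p a ≡ true → p b ≡ true → a ≡ b
countF≡1⇒unique {suc n} {p} #p≡1 {a} {b} pa pb with punchView a b
... | at        = refl
... | punched i = contradiction (trans (≡.sym pb) (countF≡0⇒false others≡0 i)) λ ()
  where
  others≡0 : countF (p ∘ punchIn a) ≡ 0
  others≡0 = suc-injective (trans (cong (λ b → indicator b + countF (p ∘ punchIn a)) (≡.sym pa))
                                  (trans (≡.sym (countF-punchIn a p)) #p≡1))

countF-≟ : ∀ {n} (w : Fin (suc n)) → countF (λ y → does (y ≟ w)) ≡ 1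
countF-≟ w = trans (countF-punchIn w (λ y → does (y ≟ w)))
  (cong₂ _+_ (cong indicator (dec-true (w ≟ w) refl))
             (false⇒countF≡0 λ i → dec-false (punchIn w i ≟ w) (punchInᵢ≢i w i)))

T-allF : ∀ {n} {p : Fin n → Bool} → T (allF p) ⇔ (∀ i → T (p i))
T-allF {zero}  = mk⇔ (λ _ ()) _
T-allF {suc n} = mk⇔
  (λ all → λ { zero → proj₁ (to T-∧ all) ; (suc i) → to T-allF (proj₂ (to T-∧ all)) i })
  (λ each → from T-∧ (each zero , from T-allF (each ∘ suc)))

T-edgeCondition : ∀ a b c → T ((not a ∨ c) ∧ (a == b)) ⇔ ((a ≡ true → c ≡ true) × a ≡ b)
T-edgeCondition true  true  true  = mk⇔ (λ _ → (λ _ → refl) , refl) _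
T-edgeCondition true  true  false = mk⇔ (λ ()) (λ (a⇒c , _) → contradiction (a⇒c refl) λ ())
T-edgeCondition true  false true  = mk⇔ (λ ()) λ ()
T-edgeCondition true  false false = mk⇔ (λ ()) λ ()
T-edgeCondition false true  _     = mk⇔ (λ ()) λ ()
T-edgeCondition false false _     = mk⇔ (λ _ → (λ ()) , refl) _

record IsEdgeSubset {n} (G : Graph n) (F : EdgeRel n) : Set where
  field
    ⊆adj      : ∀ i j → F i j ≡ true → adj G i j ≡ true
    symmetric : ∀ i j → F i j ≡ F j i

  loopless : ∀ v → F v v ≡ false
  loopless v with F v v in Fvv
  ... | false = refl
  ... | true  = contradiction (trans (≡.sym (irrefl G v)) (⊆adj v v Fvv)) λ ()

record IsPerfectMatching {n} (G : Graph n) (F : EdgeRel n) : Set where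
  field
    edgeSubset : IsEdgeSubset G F
    degF≡1     : ∀ v → degF F v ≡ 1

record IsNearPerfectMatching {n} (G : Graph n) (F : EdgeRel n) : Set where
  field
    edgeSubset   : IsEdgeSubset G F
    degF≤1       : ∀ v → degF F v ≤ 1
    oneUncovered : countF (λ v → degF F v ≡ᵇ 0) ≡ 1

T-isEdgeSubset : ∀ {n} {G : Graph n} {F} → T (isEdgeSubset G F) ⇔ IsEdgeSubset G F
T-isEdgeSubset {G = G} {F} = mk⇔
  (λ h → let condition i j = to (T-edgeCondition (F i j) (F j i) (adj G i j)) (to T-allF (to T-allF h i) j)
         in record { ⊆adj = λ i j → proj₁ (condition i j) ; symmetric = λ i j → proj₂ (condition i j) })
  (λ F⊆G → from T-allF λ i → from T-allF λ j → from (T-edgeCondition (F i j) (F j i) (adj G i j))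
    (IsEdgeSubset.⊆adj F⊆G i j , IsEdgeSubset.symmetric F⊆G i j))

T-isPerfectMatching : ∀ {n} {G : Graph n} {F} → T (isPerfectMatching G F) ⇔ IsPerfectMatching G F
T-isPerfectMatching = mk⇔
  (λ h → let matching , covered = to T-∧ h in record
    { edgeSubset = to T-isEdgeSubset (proj₁ (to T-∧ matching))
    ; degF≡1     = λ v → ≡ᵇ⇒≡ _ 1 (to T-allF covered v) })
  (λ pm → let open IsPerfectMatching pm in from T-∧
    ( from T-∧ (from T-isEdgeSubset edgeSubset , from T-allF λ v → ≤⇒≤ᵇ (≤-reflexive (degF≡1 v)))
    , from T-allF λ v → ≡⇒≡ᵇ _ 1 (degF≡1 v)))

T-isNearPerfectMatching : ∀ {n} {G : Graph n} {F} → T (isNearPerfectMatching G F) ⇔ IsNearPerfectMatching G F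
T-isNearPerfectMatching = mk⇔
  (λ h → let matching , oneUncovered = to T-∧ h ; edgeSubset , degF≤1 = to T-∧ matching in record
    { edgeSubset   = to T-isEdgeSubset edgeSubset
    ; degF≤1       = λ v → ≤ᵇ⇒≤ _ 1 (to T-allF degF≤1 v)
    ; oneUncovered = ≡ᵇ⇒≡ _ 1 oneUncovered })
  (λ npm → let open IsNearPerfectMatching npm in from T-∧
    ( from T-∧ (from T-isEdgeSubset edgeSubset , from T-allF λ v → ≤⇒≤ᵇ (degF≤1 v))
    , ≡⇒≡ᵇ _ 1 oneUncovered))

degF-cong : ∀ {n} {F F′ : EdgeRel n} → F ≐ F′ → ∀ v → degF F v ≡ degF F′ v
degF-cong F≐F′ v = countF-cong (F≐F′ v)

isMatching-cong : ∀ {n} (G : Graph n) {F F′} → F ≐ F′ → isMatching G F ≡ isMatching G F′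
isMatching-cong G F≐F′ = cong₂ _∧_
  (allF-cong λ i → allF-cong λ j → cong₂ (λ a b → (not a ∨ adj G i j) ∧ (a == b)) (F≐F′ i j) (F≐F′ j i))
  (allF-cong λ v → cong (_≤ᵇ 1) (degF-cong F≐F′ v))

isPerfectMatching-cong : ∀ {n} (G : Graph n) {F F′} → F ≐ F′ → isPerfectMatching G F ≡ isPerfectMatching G F′
isPerfectMatching-cong G F≐F′ =
  cong₂ _∧_ (isMatching-cong G F≐F′) (allF-cong λ v → cong (_≡ᵇ 1) (degF-cong F≐F′ v))

isNearPerfectMatching-cong : ∀ {n} (G : Graph n) {F F′} → F ≐ F′ → isNearPerfectMatching G F ≡ isNearPerfectMatching G F′
isNearPerfectMatching-cong G F≐F′ =
  cong₂ _∧_ (isMatching-cong G F≐F′) (cong (_≡ᵇ 1) (countF-cong λ v → cong (_≡ᵇ 0) (degF-cong F≐F′ v)))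

restrict : ∀ {n} → Fin (suc n) → EdgeRel (suc n) → EdgeRel n
restrict v F i j = F (punchIn v i) (punchIn v j)

degF-punchIn : ∀ {n} (v : Fin (suc n)) (F : EdgeRel (suc n)) x →
               degF F (punchIn v x) ≡ indicator (F (punchIn v x) v) + degF (restrict v F) x
degF-punchIn v F x = countF-punchIn v (F (punchIn v x))

restrict-isEdgeSubset : ∀ {n} {G : Graph (suc n)} {F} v → IsEdgeSubset G F →
                        IsEdgeSubset (deleteVertex G v) (restrict v F)
restrict-isEdgeSubset v F⊆G = record
  { ⊆adj      = λ i j → ⊆adj (punchIn v i) (punchIn v j)
  ; symmetric = λ i j → symmetric (punchIn v i) (punchIn v j) }
  where open IsEdgeSubset F⊆G

indicator+≡1 : ∀ b d → indicator b + d ≡ 1 → (d ≡ᵇ 0) ≡ b × d ≤ 1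
indicator+≡1 true  zero       _  = refl , z≤n
indicator+≡1 false (suc zero) _  = refl , ≤-refl

module _ {n} (G : Graph (suc n)) (v : Fin (suc n)) where

  private
    split : ∀ {F} → IsPerfectMatching G F → ∀ x →
            (degF (restrict v F) x ≡ᵇ 0) ≡ F (punchIn v x) v × degF (restrict v F) x ≤ 1
    split {F} pm x = indicator+≡1 _ _ (trans (≡.sym (degF-punchIn v F x)) (IsPerfectMatching.degF≡1 pm (punchIn v x)))

  restrict-uncovered : ∀ {F} → IsPerfectMatching G F → ∀ x → (degF (restrict v F) x ≡ᵇ 0) ≡ F (punchIn v x) v
  restrict-uncovered pm = proj₁ ∘ split pm

  restrict-isNearPerfectMatching : ∀ {F} → IsPerfectMatching G F → IsNearPerfectMatching (deleteVertex G v) (restrict v F)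
  restrict-isNearPerfectMatching {F} pm = record
    { edgeSubset   = restrict-isEdgeSubset v edgeSubset
    ; degF≤1       = proj₂ ∘ split pm
    ; oneUncovered = begin
        countF (λ x → degF (restrict v F) x ≡ᵇ 0)      ≡⟨ countF-cong (λ x → trans (restrict-uncovered pm x) (symmetric _ v)) ⟩
        countF (F v ∘ punchIn v)                        ≡⟨ cong (λ b → indicator b + countF (F v ∘ punchIn v)) (≡.sym (loopless v)) ⟩
        indicator (F v v) + countF (F v ∘ punchIn v)    ≡⟨ ≡.sym (countF-punchIn v (F v)) ⟩
        degF F v                                        ≡⟨ degF≡1 v ⟩
        1                                               ∎ }
    where
    open ≡-Reasoning
    open IsPerfectMatching pm
    open IsEdgeSubset edgeSubset

  restrict-injective : ∀ {F F′} → IsPerfectMatching G F → IsPerfectMatching G F′ →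
                       restrict v F ≐ restrict v F′ → F ≐ F′
  restrict-injective {F} {F′} pm pm′ restrictions-agree = agree
    where
    open IsEdgeSubset (IsPerfectMatching.edgeSubset pm)
    open IsEdgeSubset (IsPerfectMatching.edgeSubset pm′) renaming (symmetric to symmetric′; loopless to loopless′)

    column-agrees : ∀ x → F (punchIn v x) v ≡ F′ (punchIn v x) v
    column-agrees x = begin
      F (punchIn v x) v                    ≡⟨ ≡.sym (restrict-uncovered pm x) ⟩
      (degF (restrict v F) x ≡ᵇ 0)         ≡⟨ cong (_≡ᵇ 0) (degF-cong restrictions-agree x) ⟩
      (degF (restrict v F′) x ≡ᵇ 0)        ≡⟨ restrict-uncovered pm′ x ⟩
      F′ (punchIn v x) v                   ∎
      where open ≡-Reasoning

    agree : F ≐ F′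
    agree i j with punchView v i | punchView v j
    ... | at         | at         = trans (loopless v) (≡.sym (loopless′ v))
    ... | at         | punched j′ = trans (symmetric v _) (trans (column-agrees j′) (symmetric′ _ v))
    ... | punched i′ | at         = column-agrees i′
    ... | punched i′ | punched j′ = restrictions-agree i′ j′

  np≤nnp-deleteVertex : np G ≤ nnp (deleteVertex G v)
  np≤nnp-deleteVertex =
    countEdgeRels-mono (isPerfectMatching G) (isNearPerfectMatching (deleteVertex G v)) (restrict v)
      (isPerfectMatching-cong G) (isNearPerfectMatching-cong (deleteVertex G v))
      (λ {F} pm → from T-isNearPerfectMatching (restrict-isNearPerfectMatching {F} (to T-isPerfectMatching pm)))
      (λ {F} {F′} pm pm′ → restrict-injective {F} {F′} (to T-isPerfectMatching pm) (to T-isPerfectMatching pm′))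

does⇒witness : ∀ {A : Set} (a? : Dec A) → does a? ≡ true → A
does⇒witness (yes a) _ = a

-- Row and column u hold the indicator of w; all other entries are those of H.
extend : ∀ {n} (u w : Fin (suc n)) → EdgeRel n → EdgeRel (suc n)
extend u w H = insertAt (λ i → insertAt (H i) u (does (punchIn u i ≟ w))) u (λ y → does (y ≟ w))

module _ {n} (u w : Fin (suc n)) (H : EdgeRel n) where

  extend-row : ∀ y → extend u w H u y ≡ does (y ≟ w)
  extend-row y = cong (_$ y) (insertAt-lookup _ u _)

  private
    extend-punchIn : ∀ i y → extend u w H (punchIn u i) y ≡ insertAt (H i) u (does (punchIn u i ≟ w)) y
    extend-punchIn i y = cong (_$ y) (insertAt-punchIn _ u _ i)

  extend-column : ∀ x → extend u w H (punchIn u x) u ≡ does (punchIn u x ≟ w)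
  extend-column x = trans (extend-punchIn x u) (insertAt-lookup (H x) u _)

  restrict-extend : restrict u (extend u w H) ≐ H
  restrict-extend i j = trans (extend-punchIn i (punchIn u j)) (insertAt-punchIn (H i) u _ j)

extend-injective : ∀ {n} (u w : Fin (suc n)) {H H′} → extend u w H ≐ extend u w H′ → H ≐ H′
extend-injective u w {H} {H′} extensions-agree i j =
  trans (≡.sym (restrict-extend u w H i j)) (trans (extensions-agree _ _) (restrict-extend u w H′ i j))

module _ {n} (G : Graph (suc n)) {u w : Fin (suc n)} (uw∈E : adj G u w ≡ true) (w-pendant : degree G w ≡ 1) where

  private
    u≢w : u ≢ w
    u≢w refl = contradiction (trans (≡.sym (irrefl G u)) uw∈E) λ ()

    w′ : Fin n
    w′ = punchOut u≢w

    punchIn-w′ : punchIn u w′ ≡ w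
    punchIn-w′ = punchIn-punchOut u≢w

    only-neighbour : ∀ {y} → adj G w y ≡ true → y ≡ u
    only-neighbour wy = countF≡1⇒unique w-pendant wy (trans (Graph.sym G w u) uw∈E)

  module _ {H} (npm : IsNearPerfectMatching (deleteVertex G u) H) where
    open IsNearPerfectMatching npm
    open IsEdgeSubset edgeSubset

    w′-isolated : ∀ j → H w′ j ≡ false
    w′-isolated j with H w′ j in w′j
    ... | false = refl
    ... | true  = contradiction (only-neighbour (subst (λ x → adj G x (punchIn u j) ≡ true) punchIn-w′ (⊆adj w′ j w′j)))
                                (punchInᵢ≢i u j)

    degF-w′ : degF H w′ ≡ 0
    degF-w′ = false⇒countF≡0 w′-isolated

    degF-others : ∀ i → i ≢ w′ → degF H i ≡ 1
    degF-others i i≢w′ with degF H i in dᵢ | degF≤1 i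
    ... | 1 | _ = refl
    ... | 0 | _ = contradiction (countF≡1⇒unique oneUncovered (cong (_≡ᵇ 0) dᵢ) (cong (_≡ᵇ 0) degF-w′)) i≢w′
    ... | suc (suc _) | s≤s ()

    extend-isPerfectMatching : IsPerfectMatching G (extend u w H)
    extend-isPerfectMatching = record
      { edgeSubset = record { ⊆adj = extension⊆E ; symmetric = extension-symmetric }
      ; degF≡1     = degF-extension }
      where
      extension⊆E : ∀ x y → extend u w H x y ≡ true → adj G x y ≡ true
      extension⊆E x y e with punchView u x | punchView u y
      ... | at | _ =
        subst (λ z → adj G u z ≡ true) (≡.sym (does⇒witness (y ≟ w) (trans (≡.sym (extend-row u w H y)) e))) uw∈E
      ... | punched i | at =
        subst (λ z → adj G z u ≡ true) (≡.sym (does⇒witness (_ ≟ w) (trans (≡.sym (extend-column u w H i)) e)))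
              (trans (Graph.sym G w u) uw∈E)
      ... | punched i | punched j = ⊆adj i j (trans (≡.sym (restrict-extend u w H i j)) e)

      extension-symmetric : ∀ x y → extend u w H x y ≡ extend u w H y x
      extension-symmetric x y with punchView u x | punchView u y
      ... | at        | at        = refl
      ... | at        | punched j = trans (extend-row u w H _) (≡.sym (extend-column u w H j))
      ... | punched i | at        = trans (extend-column u w H i) (≡.sym (extend-row u w H _))
      ... | punched i | punched j =
        trans (restrict-extend u w H i j) (trans (symmetric i j) (≡.sym (restrict-extend u w H j i)))

      degF-extension : ∀ x → degF (extend u w H) x ≡ 1
      degF-extension x with punchView u x
      ... | at        = trans (countF-cong (extend-row u w H)) (countF-≟ w)
      ... | punched i = begin
        degF (extend u w H) (punchIn u i)                                ≡⟨ degF-punchIn u (extend u w H) i ⟩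
        indicator (extend u w H (punchIn u i) u) + degF (restrict u (extend u w H)) i
                                                                         ≡⟨ cong₂ _+_ (cong indicator (extend-column u w H i))
                                                                                      (degF-cong (restrict-extend u w H) i) ⟩
        indicator (does (punchIn u i ≟ w)) + degF H i                    ≡⟨ matched-once i ⟩
        1                                                                ∎
        where
        open ≡-Reasoning
        matched-once : ∀ i → indicator (does (punchIn u i ≟ w)) + degF H i ≡ 1
        matched-once i with i ≟ w′
        ... | yes refl = cong₂ _+_ (cong indicator (dec-true (_ ≟ w) punchIn-w′)) degF-w′
        ... | no i≢w′  = cong₂ _+_ (cong indicator (dec-false (_ ≟ w) λ wi → i≢w′ (punchIn-injective u i w′ (trans wi (≡.sym punchIn-w′)))))
                                   (degF-others i i≢w′)

  nnp-deleteVertex≤np : nnp (deleteVertex G u) ≤ np G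
  nnp-deleteVertex≤np =
    countEdgeRels-mono (isNearPerfectMatching (deleteVertex G u)) (isPerfectMatching G) (extend u w)
      (isNearPerfectMatching-cong (deleteVertex G u)) (isPerfectMatching-cong G)
      (λ {H} npm → from T-isPerfectMatching (extend-isPerfectMatching {H} (to T-isNearPerfectMatching npm)))
      (λ _ _ → extend-injective u w)

minOver-≤ : ∀ {n} (f : Fin (suc n) → ℕ) v → minOver f ≤ f v
minOver-≤ {zero}  f zero    = ≤-refl
minOver-≤ {suc n} f zero    = m⊓n≤m _ _
minOver-≤ {suc n} f (suc v) = ≤-trans (m⊓n≤n (f zero) _) (minOver-≤ (f ∘ suc) v)

minOver-greatest : ∀ {n} {f : Fin (suc n) → ℕ} {m} → (∀ v → m ≤ f v) → m ≤ minOver f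
minOver-greatest {zero}  m≤f = m≤f zero
minOver-greatest {suc n} m≤f = ⊓-glb (m≤f zero) (minOver-greatest (m≤f ∘ suc))

mainTheorem3 : (n : ℕ) (G : Graph (suc n)) (u w : Fin (suc n)) →
               adj G u w ≡ true → degree G w ≡ 1 →
               (np G ≡ nnp (deleteVertex G u))
               × ((v : Fin (suc n)) → nnp (deleteVertex G u) ≤ nnp (deleteVertex G v))
               × (np G ≡ minOver (λ v → nnp (deleteVertex G v)))
mainTheorem3 n G u w uw∈E w-pendant = np≡nnp-u , nnp-u-minimal , np≡minimum
  where
  np≡nnp-u : np G ≡ nnp (deleteVertex G u)
  np≡nnp-u = ≤-antisym (np≤nnp-deleteVertex G u) (nnp-deleteVertex≤np G uw∈E w-pendant)

  nnp-u-minimal : ∀ v → nnp (deleteVertex G u) ≤ nnp (deleteVertex G v)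
  nnp-u-minimal v = subst (_≤ nnp (deleteVertex G v)) np≡nnp-u (np≤nnp-deleteVertex G v)

  np≡minimum : np G ≡ minOver (λ v → nnp (deleteVertex G v))
  np≡minimum = ≤-antisym (minOver-greatest (np≤nnp-deleteVertex G))
                         (subst (minOver (λ v → nnp (deleteVertex G v)) ≤_) (≡.sym np≡nnp-u) (minOver-≤ _ u))
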